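{- Let $G=(V,E)$ be a graph with $V=\{1,\dots,n\}$ and let $v\colon V\to\mathbb{R}^d$ be a full-dimensional $\Sigma$-realization of $G$ for some $\Sigma\subseteq\mathrm{Aut}(G)$ acting transitively on the arcs of $G$. If $v$ is reducible, then $v$ is not of full local dimension.
   Context: $G$ is a finite simple undirected graph; $N(i)$ is the neighbourhood of $i$; an arc is an ordered pair $(i,j)$ with $ij\in E$. A realization $v\colon V\to\mathbb{R}^d$ is full-dimensional if the $v_i$ span $\mathbb{R}^d$, and of full local dimension if for every $i\in V$ the vectors $\{v_j-v_i:j\in N(i)\}$ span $\mathbb{R}^d$. It is a $\Sigma$-realization if there is a group homomorphism $T\colon\Sigma\to\mathrm{O}(\mathbb{R}^d)$ with $T_\sigma v_i=v_{\sigma(i)}$ for all $i,\sigma$; it is reducible if $T$ has an invariant subspace other than $\{0\}$ and $\mathbb{R}^d$. -}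

module Defs where

open import Data.Nat using (ℕ; zero; suc)
open import Data.Fin using (Fin; zero; suc)
open import Data.Bool using (Bool; true; false)
open import Data.Product using (Σ; ∃; ∃-syntax; _×_; _,_)
open import Data.Sum using (_⊎_)
open import Relation.Nullary using (¬_)
open import Relation.Binary.PropositionalEquality using (_≡_)
open import Relation.Binary.Structures using (IsStrictTotalOrder)
open import Algebra.Structures using (IsCommutativeRing)
open import Data.Fin.Permutation using (Permutation′; _⟨$⟩ʳ_; _∘ₚ_; id; flip)

-- The real numbers, axiomatised as a complete ordered field
-- (categorical: any model is isomorphic to ℝ).

record RealField : Set₁ where
  infixl 6 _+_
  infixl 7 _*_
  infix  4 _<_ _≤_
  field
    ℝ    : Set
    _+_  : ℝ → ℝ → ℝ
    _*_  : ℝ → ℝ → ℝ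
    -_   : ℝ → ℝ
    0ℝ   : ℝ
    1ℝ   : ℝ
    _<_  : ℝ → ℝ → Set
    isCommutativeRing : IsCommutativeRing _≡_ _+_ _*_ -_ 0ℝ 1ℝ
    0≢1  : ¬ (0ℝ ≡ 1ℝ)
    inverse : ∀ x → ¬ (x ≡ 0ℝ) → ∃[ y ] (x * y ≡ 1ℝ)
    isStrictTotalOrder : IsStrictTotalOrder _≡_ _<_
    +-mono-< : ∀ {a b} c → a < b → a + c < b + c
    *-pos    : ∀ {a b} → 0ℝ < a → 0ℝ < b → 0ℝ < a * b

  _≤_ : ℝ → ℝ → Set
  a ≤ b = a < b ⊎ a ≡ b

  field
    complete : (P : ℝ → Set) → ∃ P → (∃[ b ] (∀ x → P x → x ≤ b)) →
               ∃[ s ] ((∀ x → P x → x ≤ s) ×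
                       (∀ b → (∀ x → P x → x ≤ b) → s ≤ b))

record Graph (n : ℕ) : Set where
  field
    adj   : Fin n → Fin n → Bool
    sym   : ∀ i j → adj i j ≡ adj j i
    irrefl : ∀ i → adj i i ≡ false

open Graph public

IsAut : ∀ {n} → Graph n → Permutation′ n → Set
IsAut G σ = ∀ i j → adj G (σ ⟨$⟩ʳ i) (σ ⟨$⟩ʳ j) ≡ adj G i j

_≈ₚ_ : ∀ {n} → Permutation′ n → Permutation′ n → Set
σ ≈ₚ τ = ∀ i → σ ⟨$⟩ʳ i ≡ τ ⟨$⟩ʳ i

record SubgroupAut {n} (G : Graph n) : Set₁ where
  field
    mem      : Permutation′ n → Set
    mem-resp : ∀ {σ τ} → σ ≈ₚ τ → mem σ → mem τ
    mem-aut  : ∀ {σ} → mem σ → IsAut G σ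
    mem-id   : mem id
    -- σ ∘ τ (apply τ first) is  τ ∘ₚ σ  in stdlib's diagrammatic notation
    mem-comp : ∀ {σ τ} → mem σ → mem τ → mem (τ ∘ₚ σ)
    mem-inv  : ∀ {σ} → mem σ → mem (flip σ)

open SubgroupAut public

ArcTransitive : ∀ {n} {G : Graph n} → SubgroupAut G → Set
ArcTransitive {n} {G} S =
  ∀ i j k l → adj G i j ≡ true → adj G k l ≡ true →
  ∃[ σ ] (mem S σ × (σ ⟨$⟩ʳ i ≡ k) × (σ ⟨$⟩ʳ j ≡ l))

module LinAlg (R : RealField) where
  open RealField R

  ∑ : ∀ {k} → (Fin k → ℝ) → ℝ
  ∑ {zero}  f = 0ℝ
  ∑ {suc k} f = f zero + ∑ (λ i → f (suc i))

  Vec : ℕ → Set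
  Vec d = Fin d → ℝ

  Mat : ℕ → Set
  Mat d = Fin d → Fin d → ℝ

  _≈_ : ∀ {d} → Vec d → Vec d → Set
  x ≈ y = ∀ k → x k ≡ y k

  _≈ₘ_ : ∀ {d} → Mat d → Mat d → Set
  M ≈ₘ N = ∀ k l → M k l ≡ N k l

  0v : ∀ {d} → Vec d
  0v k = 0ℝ

  _+v_ : ∀ {d} → Vec d → Vec d → Vec d
  (x +v y) k = x k + y k

  _-v_ : ∀ {d} → Vec d → Vec d → Vec d
  (x -v y) k = x k + (- (y k))

  _·v_ : ∀ {d} → ℝ → Vec d → Vec d
  (a ·v x) k = a * x k

  _·_ : ∀ {d} → Mat d → Vec d → Vec d
  (M · x) k = ∑ (λ l → M k l * x l)

  _⊗_ : ∀ {d} → Mat d → Mat d → Mat d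
  (M ⊗ N) k l = ∑ (λ m → M k m * N m l)

  transpose : ∀ {d} → Mat d → Mat d
  transpose M k l = M l k

  I : ∀ {d} → Mat d
  I zero    zero    = 1ℝ
  I zero    (suc l) = 0ℝ
  I (suc k) zero    = 0ℝ
  I (suc k) (suc l) = I k l

  Orthogonal : ∀ {d} → Mat d → Set
  Orthogonal M = (transpose M ⊗ M) ≈ₘ I

  lincomb : ∀ {k d} → (Fin k → ℝ) → (Fin k → Vec d) → Vec d
  lincomb c u m = ∑ (λ i → c i * u i m)

  Spans : ∀ {k d} → (Fin k → Vec d) → Set
  Spans {k} {d} u = ∀ (w : Vec d) → ∃[ c ] (w ≈ lincomb c u)

  record Subspace (d : ℕ) : Set₁ where
    field
      mem     : Vec d → Set
      mem-0   : mem 0v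
      mem-+   : ∀ {x y} → mem x → mem y → mem (x +v y)
      mem-·   : ∀ a {x} → mem x → mem (a ·v x)
      mem-resp : ∀ {x y} → x ≈ y → mem x → mem y

  FullDimensional : ∀ {n d} → (Fin n → Vec d) → Set
  FullDimensional v = Spans v

  -- for every i, {v_j - v_i : j ∈ N(i)} spans ℝ^d
  -- (coefficients of non-neighbours are forced to be 0)
  FullLocalDimension : ∀ {n d} → Graph n → (Fin n → Vec d) → Set
  FullLocalDimension {n} {d} G v =
    ∀ (i : Fin n) (w : Vec d) →
      ∃[ c ] ((∀ j → adj G i j ≡ false → c j ≡ 0ℝ) ×
              (w ≈ lincomb c (λ j → v j -v v i)))

  record SymRep {n d} {G : Graph n} (S : SubgroupAut G)
                (v : Fin n → Vec d) : Set₁ where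
    field
      T        : (σ : Permutation′ n) → mem S σ → Mat d
      T-wd     : ∀ {σ τ} (p : mem S σ) (q : mem S τ) → σ ≈ₚ τ → T σ p ≈ₘ T τ q
      T-orth   : ∀ {σ} (p : mem S σ) → Orthogonal (T σ p)
      T-hom    : ∀ {σ τ} (p : mem S σ) (q : mem S τ) →
                 T (τ ∘ₚ σ) (mem-comp S p q) ≈ₘ (T σ p ⊗ T τ q)
      T-real   : ∀ {σ} (p : mem S σ) i → (T σ p · v i) ≈ v (σ ⟨$⟩ʳ i)

  SymRealization : ∀ {n d} {G : Graph n} → SubgroupAut G → (Fin n → Vec d) → Set₁
  SymRealization S v = SymRep S v

  Reducible : ∀ {n d} {G : Graph n} {S : SubgroupAut G} {v : Fin n → Vec d} →
              SymRep S v → Set₁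
  Reducible {n} {d} {S = S} ρ =
    Σ (Subspace d) λ U →
      (∃[ u ] (Subspace.mem U u × ¬ (u ≈ 0v))) ×
      (∃[ w ] ¬ Subspace.mem U w) ×
      (∀ {σ} (p : mem S σ) {x} → Subspace.mem U x →
         Subspace.mem U (SymRep.T ρ σ p · x))

-- Let U be a nonzero proper invariant subspace and u ∈ U nonzero. Since the v_k span ℝ^d,
-- ⟨u, v_i⟩ ≠ 0 for some vertex i, and averaging ⟨u, v_i⟩ u over the stabiliser Σ_i gives a
-- Σ_i-fixed vector y ∈ U with ⟨v_i, y⟩ > 0. By arc-transitivity Σ_i is transitive on N(i), so a
-- Σ_i-fixed vector has the same inner product with every edge vector v_j − v_i (j ∈ N(i)); when
-- these span ℝ^d, the Σ_i-fixed vectors are therefore the multiples of v_i. Thus v_i ∈ U, hence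
-- every v_k ∈ U by vertex-transitivity, and U = ℝ^d by full-dimensionality.
module Submission where

open import Defs hiding (sym; irrefl; mem; mem-resp; mem-aut; mem-id; mem-comp; mem-inv)
open import Data.Nat using (ℕ; zero; suc)
open import Data.Fin using (Fin; zero; suc)
open import Data.Fin.Properties using (¬∀⟶∃¬)
open import Data.Fin.Permutation using (Permutation′; _⟨$⟩ʳ_; _∘ₚ_; id; flip; inverseˡ)
import Data.Vec as V
open import Data.Vec using (_∷_; [])
open import Data.Vec.Properties using (lookup-map; lookup-allFin)
open import Data.Bool using (true; false)
import Data.Bool.Properties as Bool
open import Data.Product using (∃-syntax; _×_; _,_; proj₁; proj₂; map₂)
open import Data.Sum using (inj₁; inj₂)
open import Data.Empty using (⊥-elim)
open import Relation.Nullary using (¬_; Dec; yes; no)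
open import Relation.Nullary.Decidable using (¬¬-excluded-middle)
open import Relation.Nullary.Negation using (¬¬-map)
open import Relation.Binary.PropositionalEquality
open import Relation.Binary.Structures using (IsStrictTotalOrder)
open import Relation.Binary.Definitions using (tri<; tri≈; tri>)
open import Algebra.Bundles using (CommutativeRing)
import Algebra.Properties.Ring as RingProperties
import Algebra.Properties.CommutativeSemigroup as CommutativeSemigroupProperties
import Algebra.Properties.Semiring.Sum as SemiringSum

module FieldProperties (R : RealField) where
  open RealField R
  open ≡-Reasoning

  commutativeRing : CommutativeRing _ _
  commutativeRing = record { isCommutativeRing = isCommutativeRing }

  open CommutativeRing commutativeRing public
    using ( +-comm; +-identityˡ; -‿inverseʳ; *-assoc; *-comm; *-identityˡ
          ; zeroˡ; zeroʳ; ring; semiring; *-commutativeSemigroup )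
  open RingProperties ring public
    using (-‿distribˡ-*; -‿distribʳ-*; -‿involutive; -1*x≈-x; x[y-z]≈xy-xz; x∙y⁻¹≈ε⇒x≈y)
  open CommutativeSemigroupProperties *-commutativeSemigroup public
    using (x∙yz≈y∙xz; xy∙z≈y∙xz)
  open IsStrictTotalOrder isStrictTotalOrder public
    using (_≟_; compare) renaming (trans to <-trans)

  <-irrefl : ∀ {x} → ¬ (x < x)
  <-irrefl = IsStrictTotalOrder.irrefl isStrictTotalOrder refl

  ≤-<-trans : ∀ {a b c} → a ≤ b → b < c → a < c
  ≤-<-trans (inj₁ a<b) b<c = <-trans a<b b<c
  ≤-<-trans (inj₂ refl) b<c = b<c

  +-pos-nonneg : ∀ {a b} → 0ℝ < a → 0ℝ ≤ b → 0ℝ < a + b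
  +-pos-nonneg {a} {b} 0<a 0≤b =
    ≤-<-trans (subst (0ℝ ≤_) (sym (+-identityˡ b)) 0≤b) (+-mono-< b 0<a)

  +-nonneg-pos : ∀ {a b} → 0ℝ ≤ a → 0ℝ < b → 0ℝ < a + b
  +-nonneg-pos {a} {b} 0≤a 0<b = subst (0ℝ <_) (+-comm b a) (+-pos-nonneg 0<b 0≤a)

  +-nonneg : ∀ {a b} → 0ℝ ≤ a → 0ℝ ≤ b → 0ℝ ≤ a + b
  +-nonneg (inj₁ 0<a) 0≤b = inj₁ (+-pos-nonneg 0<a 0≤b)
  +-nonneg {b = b} (inj₂ refl) 0≤b = subst (0ℝ ≤_) (sym (+-identityˡ b)) 0≤b

  neg-pos : ∀ {x} → x < 0ℝ → 0ℝ < - x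
  neg-pos {x} x<0 = subst₂ _<_ (-‿inverseʳ x) (+-identityˡ (- x)) (+-mono-< (- x) x<0)

  -x*-x≡x*x : ∀ x → (- x) * (- x) ≡ x * x
  -x*-x≡x*x x = begin
    (- x) * (- x)  ≡⟨ sym (-‿distribˡ-* x (- x)) ⟩
    - (x * (- x))  ≡⟨ cong -_ (sym (-‿distribʳ-* x x)) ⟩
    - (- (x * x))  ≡⟨ -‿involutive (x * x) ⟩
    x * x          ∎

  x≢0⇒0<x*x : ∀ {x} → ¬ (x ≡ 0ℝ) → 0ℝ < x * x
  x≢0⇒0<x*x {x} x≢0 with compare x 0ℝ
  ... | tri< x<0 _ _ = subst (0ℝ <_) (-x*-x≡x*x x) (*-pos (neg-pos x<0) (neg-pos x<0))
  ... | tri≈ _ x≡0 _ = ⊥-elim (x≢0 x≡0)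
  ... | tri> _ _ 0<x = *-pos 0<x 0<x

  0≤x*x : ∀ x → 0ℝ ≤ x * x
  0≤x*x x with x ≟ 0ℝ
  ... | yes refl = inj₂ (sym (zeroˡ 0ℝ))
  ... | no x≢0   = inj₁ (x≢0⇒0<x*x x≢0)

module Euclidean (R : RealField) where
  open RealField R
  open FieldProperties R
  open LinAlg R public
  open ≡-Reasoning
  private module Sum = SemiringSum semiring

  ∑-cong : ∀ {k} {f g : Fin k → ℝ} → (∀ i → f i ≡ g i) → ∑ f ≡ ∑ g
  ∑-cong {zero}  eq = refl
  ∑-cong {suc k} eq = cong₂ _+_ (eq zero) (∑-cong (λ i → eq (suc i)))

  ∑≡sum : ∀ {k} (f : Fin k → ℝ) → ∑ f ≡ Sum.sum f
  ∑≡sum {zero}  f = refl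
  ∑≡sum {suc k} f = cong (f zero +_) (∑≡sum (λ i → f (suc i)))

  ∑-zero : ∀ {k} {f : Fin k → ℝ} → (∀ i → f i ≡ 0ℝ) → ∑ f ≡ 0ℝ
  ∑-zero {zero}  eq = refl
  ∑-zero {suc k} eq = trans (cong₂ _+_ (eq zero) (∑-zero (λ i → eq (suc i)))) (+-identityˡ 0ℝ)

  ∑-+ : ∀ {k} (f g : Fin k → ℝ) → ∑ (λ i → f i + g i) ≡ ∑ f + ∑ g
  ∑-+ f g = begin
    ∑ (λ i → f i + g i)        ≡⟨ ∑≡sum (λ i → f i + g i) ⟩
    Sum.sum (λ i → f i + g i)  ≡⟨ Sum.∑-distrib-+ f g ⟩
    Sum.sum f + Sum.sum g      ≡⟨ sym (cong₂ _+_ (∑≡sum f) (∑≡sum g)) ⟩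
    ∑ f + ∑ g                  ∎

  ∑-*ˡ : ∀ {k} c (f : Fin k → ℝ) → c * ∑ f ≡ ∑ (λ i → c * f i)
  ∑-*ˡ c f = begin
    c * ∑ f                  ≡⟨ cong (c *_) (∑≡sum f) ⟩
    c * Sum.sum f            ≡⟨ Sum.*-distribˡ-sum c f ⟩
    Sum.sum (λ i → c * f i)  ≡⟨ sym (∑≡sum (λ i → c * f i)) ⟩
    ∑ (λ i → c * f i)        ∎

  ∑-*ʳ : ∀ {k} c (f : Fin k → ℝ) → ∑ f * c ≡ ∑ (λ i → f i * c)
  ∑-*ʳ c f = begin
    ∑ f * c                  ≡⟨ cong (_* c) (∑≡sum f) ⟩
    Sum.sum f * c            ≡⟨ Sum.*-distribʳ-sum c f ⟩
    Sum.sum (λ i → f i * c)  ≡⟨ sym (∑≡sum (λ i → f i * c)) ⟩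
    ∑ (λ i → f i * c)        ∎

  ∑-neg : ∀ {k} (f : Fin k → ℝ) → ∑ (λ i → - f i) ≡ - ∑ f
  ∑-neg f = begin
    ∑ (λ i → - f i)       ≡⟨ ∑-cong (λ i → sym (-1*x≈-x (f i))) ⟩
    ∑ (λ i → - 1ℝ * f i)  ≡⟨ sym (∑-*ˡ (- 1ℝ) f) ⟩
    - 1ℝ * ∑ f            ≡⟨ -1*x≈-x (∑ f) ⟩
    - ∑ f                 ∎

  ∑-comm : ∀ {k l} (f : Fin k → Fin l → ℝ) →
           ∑ (λ i → ∑ (λ j → f i j)) ≡ ∑ (λ j → ∑ (λ i → f i j))
  ∑-comm f = begin
    ∑ (λ i → ∑ (f i))
      ≡⟨ trans (∑-cong (λ i → ∑≡sum (f i))) (∑≡sum (λ i → Sum.sum (f i))) ⟩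
    Sum.sum (λ i → Sum.sum (f i))
      ≡⟨ Sum.∑-comm f ⟩
    Sum.sum (λ j → Sum.sum (λ i → f i j))
      ≡⟨ sym (trans (∑-cong (λ j → ∑≡sum (λ i → f i j))) (∑≡sum (λ j → Sum.sum (λ i → f i j)))) ⟩
    ∑ (λ j → ∑ (λ i → f i j)) ∎

  ∑-permute : ∀ {k} (f : Fin k → ℝ) (π : Permutation′ k) → ∑ (λ i → f (π ⟨$⟩ʳ i)) ≡ ∑ f
  ∑-permute f π = begin
    ∑ (λ i → f (π ⟨$⟩ʳ i))        ≡⟨ ∑≡sum (λ i → f (π ⟨$⟩ʳ i)) ⟩
    Sum.sum (λ i → f (π ⟨$⟩ʳ i))  ≡⟨ sym (Sum.∑-permute f π) ⟩
    Sum.sum f                     ≡⟨ sym (∑≡sum f) ⟩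
    ∑ f                           ∎

  ∑-nonneg : ∀ {k} (f : Fin k → ℝ) → (∀ i → 0ℝ ≤ f i) → 0ℝ ≤ ∑ f
  ∑-nonneg {zero}  f h = inj₂ refl
  ∑-nonneg {suc k} f h = +-nonneg (h zero) (∑-nonneg _ (λ i → h (suc i)))

  ∑-pos : ∀ {k} (f : Fin k → ℝ) → (∀ i → 0ℝ ≤ f i) → ∀ i₀ → 0ℝ < f i₀ → 0ℝ < ∑ f
  ∑-pos {suc k} f h zero     p = +-pos-nonneg p (∑-nonneg _ (λ i → h (suc i)))
  ∑-pos {suc k} f h (suc i₀) p = +-nonneg-pos (h zero) (∑-pos _ (λ i → h (suc i)) i₀ p)

  ⟪_,_⟫ : ∀ {d} → Vec d → Vec d → ℝ
  ⟪ x , y ⟫ = ∑ (λ k → x k * y k)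

  ⟪⟫-cong : ∀ {d} {x x′ y y′ : Vec d} → x ≈ x′ → y ≈ y′ → ⟪ x , y ⟫ ≡ ⟪ x′ , y′ ⟫
  ⟪⟫-cong x≈x′ y≈y′ = ∑-cong (λ k → cong₂ _*_ (x≈x′ k) (y≈y′ k))

  ⟪⟫-comm : ∀ {d} (x y : Vec d) → ⟪ x , y ⟫ ≡ ⟪ y , x ⟫
  ⟪⟫-comm x y = ∑-cong (λ k → *-comm (x k) (y k))

  ⟪⟫-0ʳ : ∀ {d} (x : Vec d) → ⟪ x , 0v ⟫ ≡ 0ℝ
  ⟪⟫-0ʳ x = ∑-zero (λ k → zeroʳ (x k))

  ⟪⟫-0ˡ : ∀ {d} (x : Vec d) → ⟪ 0v , x ⟫ ≡ 0ℝ
  ⟪⟫-0ˡ x = ∑-zero (λ k → zeroˡ (x k))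

  ⟪⟫-·ʳ : ∀ {d} (x : Vec d) a (y : Vec d) → ⟪ x , a ·v y ⟫ ≡ a * ⟪ x , y ⟫
  ⟪⟫-·ʳ x a y = trans (∑-cong (λ k → x∙yz≈y∙xz (x k) a (y k))) (sym (∑-*ˡ a (λ k → x k * y k)))

  ⟪⟫-·ˡ : ∀ {d} a (x y : Vec d) → ⟪ a ·v x , y ⟫ ≡ a * ⟪ x , y ⟫
  ⟪⟫-·ˡ a x y = trans (∑-cong (λ k → *-assoc a (x k) (y k))) (sym (∑-*ˡ a (λ k → x k * y k)))

  ⟪⟫--ʳ : ∀ {d} (x y z : Vec d) → ⟪ x , y -v z ⟫ ≡ ⟪ x , y ⟫ + - ⟪ x , z ⟫
  ⟪⟫--ʳ x y z = begin
    ∑ (λ k → x k * (y k + - z k))        ≡⟨ ∑-cong (λ k → x[y-z]≈xy-xz (x k) (y k) (z k)) ⟩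
    ∑ (λ k → x k * y k + - (x k * z k))  ≡⟨ ∑-+ (λ k → x k * y k) (λ k → - (x k * z k)) ⟩
    ⟪ x , y ⟫ + ∑ (λ k → - (x k * z k))  ≡⟨ cong (⟪ x , y ⟫ +_) (∑-neg (λ k → x k * z k)) ⟩
    ⟪ x , y ⟫ + - ⟪ x , z ⟫              ∎

  ∑ᵥ : ∀ {k d} → (Fin k → Vec d) → Vec d
  ∑ᵥ F m = ∑ (λ i → F i m)

  ⟪⟫-∑ᵥʳ : ∀ {k d} (x : Vec d) (F : Fin k → Vec d) → ⟪ x , ∑ᵥ F ⟫ ≡ ∑ (λ i → ⟪ x , F i ⟫)
  ⟪⟫-∑ᵥʳ x F = begin
    ∑ (λ m → x m * ∑ (λ i → F i m))  ≡⟨ ∑-cong (λ m → ∑-*ˡ (x m) (λ i → F i m)) ⟩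
    ∑ (λ m → ∑ (λ i → x m * F i m))  ≡⟨ ∑-comm (λ m i → x m * F i m) ⟩
    ∑ (λ i → ⟪ x , F i ⟫)            ∎

  ⟪⟫-lincombʳ : ∀ {k d} (x : Vec d) (c : Fin k → ℝ) (F : Fin k → Vec d) →
                ⟪ x , lincomb c F ⟫ ≡ ∑ (λ i → c i * ⟪ x , F i ⟫)
  ⟪⟫-lincombʳ x c F =
    trans (⟪⟫-∑ᵥʳ x (λ i → c i ·v F i)) (∑-cong (λ i → ⟪⟫-·ʳ x (c i) (F i)))

  ⟪⟫-transposeˡ : ∀ {d} (M : Mat d) (x z : Vec d) → ⟪ M · x , z ⟫ ≡ ⟪ x , transpose M · z ⟫
  ⟪⟫-transposeˡ M x z = begin
    ∑ (λ k → ∑ (λ l → M k l * x l) * z k)    ≡⟨ ∑-cong (λ k → ∑-*ʳ (z k) (λ l → M k l * x l)) ⟩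
    ∑ (λ k → ∑ (λ l → M k l * x l * z k))    ≡⟨ ∑-comm (λ k l → M k l * x l * z k) ⟩
    ∑ (λ l → ∑ (λ k → M k l * x l * z k))    ≡⟨ ∑-cong (λ l → ∑-cong (λ k → xy∙z≈y∙xz (M k l) (x l) (z k))) ⟩
    ∑ (λ l → ∑ (λ k → x l * (M k l * z k)))  ≡⟨ ∑-cong (λ l → sym (∑-*ˡ (x l) (λ k → M k l * z k))) ⟩
    ⟪ x , transpose M · z ⟫                  ∎

  ⟪⟫-definite : ∀ {d} (x : Vec d) → ⟪ x , x ⟫ ≡ 0ℝ → x ≈ 0v
  ⟪⟫-definite x ⟪x,x⟫≡0 k with x k ≟ 0ℝ
  ... | yes xₖ≡0 = xₖ≡0
  ... | no  xₖ≢0 = ⊥-elim (<-irrefl (subst (0ℝ <_) ⟪x,x⟫≡0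
                     (∑-pos _ (λ l → 0≤x*x (x l)) k (x≢0⇒0<x*x xₖ≢0))))

  ⟂-lincomb⇒≈0 : ∀ {k d} {c : Fin k → ℝ} {F : Fin k → Vec d} {z : Vec d} →
                 z ≈ lincomb c F → (∀ i → c i * ⟪ z , F i ⟫ ≡ 0ℝ) → z ≈ 0v
  ⟂-lincomb⇒≈0 {c = c} {F} {z} z≈ terms≡0 = ⟪⟫-definite z (begin
    ⟪ z , z ⟫                          ≡⟨ ⟪⟫-cong (λ _ → refl) z≈ ⟩
    ⟪ z , lincomb c F ⟫                ≡⟨ ⟪⟫-lincombʳ z c F ⟩
    ∑ (λ i → c i * ⟪ z , F i ⟫)        ≡⟨ ∑-zero terms≡0 ⟩
    0ℝ                                 ∎)

  ⟂-spanning⇒≈0 : ∀ {k d} {F : Fin k → Vec d} → Spans F →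
                  ∀ {z} → (∀ i → ⟪ z , F i ⟫ ≡ 0ℝ) → z ≈ 0v
  ⟂-spanning⇒≈0 spans {z} ⟂ with spans z
  ... | c , z≈ = ⟂-lincomb⇒≈0 z≈ (λ i → trans (cong (c i *_) (⟂ i)) (zeroʳ (c i)))

  spanning⇒not-orthogonal : ∀ {k d} {F : Fin k → Vec d} → Spans F →
                            ∀ {z} → ¬ (z ≈ 0v) → ∃[ i ] ¬ (⟪ z , F i ⟫ ≡ 0ℝ)
  spanning⇒not-orthogonal {k} {F = F} spans {z} z≉0 =
    ¬∀⟶∃¬ k (λ i → ⟪ z , F i ⟫ ≡ 0ℝ) (λ i → ⟪ z , F i ⟫ ≟ 0ℝ) (λ ⟂ → z≉0 (⟂-spanning⇒≈0 spans ⟂))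

  ·-congˡ : ∀ {d} {M N : Mat d} → M ≈ₘ N → ∀ x → (M · x) ≈ (N · x)
  ·-congˡ M≈N x k = ∑-cong (λ l → cong (_* x l) (M≈N k l))

  ·-0 : ∀ {d} (M : Mat d) → (M · 0v) ≈ 0v
  ·-0 M k = ⟪⟫-0ʳ (M k)

  ·-- : ∀ {d} (M : Mat d) (x y : Vec d) → (M · (x -v y)) ≈ ((M · x) -v (M · y))
  ·-- M x y k = ⟪⟫--ʳ (M k) x y

  ·-⊗ : ∀ {d} (M N : Mat d) (x : Vec d) → (M · (N · x)) ≈ ((M ⊗ N) · x)
  ·-⊗ M N x k = begin
    ∑ (λ l → M k l * ∑ (λ m → N l m * x m))
      ≡⟨ ∑-cong (λ l → ∑-*ˡ (M k l) (λ m → N l m * x m)) ⟩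
    ∑ (λ l → ∑ (λ m → M k l * (N l m * x m)))
      ≡⟨ ∑-comm (λ l m → M k l * (N l m * x m)) ⟩
    ∑ (λ m → ∑ (λ l → M k l * (N l m * x m)))
      ≡⟨ ∑-cong (λ m → ∑-cong (λ l → sym (*-assoc (M k l) (N l m) (x m)))) ⟩
    ∑ (λ m → ∑ (λ l → M k l * N l m * x m))
      ≡⟨ ∑-cong (λ m → sym (∑-*ʳ (x m) (λ l → M k l * N l m))) ⟩
    ((M ⊗ N) · x) k ∎

  I-· : ∀ {d} (x : Vec d) → (I · x) ≈ x
  I-· {suc d} x zero    = trans (cong₂ _+_ (*-identityˡ (x zero)) (∑-zero (λ l → zeroˡ (x (suc l)))))
                                (trans (+-comm (x zero) 0ℝ) (+-identityˡ (x zero)))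
  I-· {suc d} x (suc k) = trans (cong₂ _+_ (zeroˡ (x zero)) (I-· (λ l → x (suc l)) k)) (+-identityˡ _)

  orthogonal⇒⟪⟫-preserved : ∀ {d} {M : Mat d} → Orthogonal M → ∀ x y → ⟪ M · x , M · y ⟫ ≡ ⟪ x , y ⟫
  orthogonal⇒⟪⟫-preserved {M = M} orth x y = begin
    ⟪ M · x , M · y ⟫              ≡⟨ ⟪⟫-transposeˡ M x (M · y) ⟩
    ⟪ x , transpose M · (M · y) ⟫  ≡⟨ ⟪⟫-cong (λ _ → refl) (·-⊗ (transpose M) M y) ⟩
    ⟪ x , (transpose M ⊗ M) · y ⟫  ≡⟨ ⟪⟫-cong (λ _ → refl) (·-congˡ orth y) ⟩
    ⟪ x , I · y ⟫                  ≡⟨ ⟪⟫-cong (λ _ → refl) (I-· y) ⟩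
    ⟪ x , y ⟫                      ∎

  infix 4 _∈_
  _∈_ : ∀ {d} → Vec d → Subspace d → Set
  x ∈ U = Subspace.mem U x

  module _ {d} (U : Subspace d) where
    open Subspace U using (mem-0; mem-+; mem-·; mem-resp)

    ∑ᵥ-mem : ∀ {k} {F : Fin k → Vec d} → (∀ i → F i ∈ U) → ∑ᵥ F ∈ U
    ∑ᵥ-mem {zero}  F∈U = mem-0
    ∑ᵥ-mem {suc k} F∈U = mem-+ (F∈U zero) (∑ᵥ-mem (λ i → F∈U (suc i)))

    lincomb-mem : ∀ {k} (c : Fin k → ℝ) {F : Fin k → Vec d} → (∀ i → F i ∈ U) → lincomb c F ∈ U
    lincomb-mem c F∈U = ∑ᵥ-mem (λ i → mem-· (c i) (F∈U i))

    spanning⇒all-mem : ∀ {k} {F : Fin k → Vec d} → Spans F → (∀ i → F i ∈ U) → ∀ w → w ∈ U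
    spanning⇒all-mem spans F∈U w with spans w
    ... | c , w≈ = mem-resp (λ m → sym (w≈ m)) (lincomb-mem c F∈U)

  ∑ⱽ : ∀ {k} m → (V.Vec (Fin k) m → ℝ) → ℝ
  ∑ⱽ zero    F = F []
  ∑ⱽ (suc m) F = ∑ (λ a → ∑ⱽ m (λ f → F (a ∷ f)))

  ∑ⱽᵥ : ∀ {k d} m → (V.Vec (Fin k) m → Vec d) → Vec d
  ∑ⱽᵥ m F l = ∑ⱽ m (λ f → F f l)

  ∑ⱽ-cong : ∀ {k} m {F G : V.Vec (Fin k) m → ℝ} → (∀ f → F f ≡ G f) → ∑ⱽ m F ≡ ∑ⱽ m G
  ∑ⱽ-cong zero    eq = eq []
  ∑ⱽ-cong (suc m) eq = ∑-cong (λ a → ∑ⱽ-cong m (λ f → eq (a ∷ f)))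

  ∑ⱽ-map-permute : ∀ {k} m (π : Permutation′ k) (F : V.Vec (Fin k) m → ℝ) →
                   ∑ⱽ m (λ f → F (V.map (π ⟨$⟩ʳ_) f)) ≡ ∑ⱽ m F
  ∑ⱽ-map-permute zero    π F = refl
  ∑ⱽ-map-permute (suc m) π F =
    trans (∑-cong (λ a → ∑ⱽ-map-permute m π (λ f → F ((π ⟨$⟩ʳ a) ∷ f))))
          (∑-permute (λ a → ∑ⱽ m (λ f → F (a ∷ f))) π)

  ∑ⱽ-nonneg : ∀ {k} m (F : V.Vec (Fin k) m → ℝ) → (∀ f → 0ℝ ≤ F f) → 0ℝ ≤ ∑ⱽ m F
  ∑ⱽ-nonneg zero    F h = h []
  ∑ⱽ-nonneg (suc m) F h = ∑-nonneg _ (λ a → ∑ⱽ-nonneg m _ (λ f → h (a ∷ f)))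

  ∑ⱽ-pos : ∀ {k} m (F : V.Vec (Fin k) m → ℝ) → (∀ f → 0ℝ ≤ F f) → ∀ f₀ → 0ℝ < F f₀ → 0ℝ < ∑ⱽ m F
  ∑ⱽ-pos zero    F h [] p = p
  ∑ⱽ-pos (suc m) F h (a ∷ f₀) p =
    ∑-pos _ (λ b → ∑ⱽ-nonneg m _ (λ f → h (b ∷ f))) a (∑ⱽ-pos m _ (λ f → h (a ∷ f)) f₀ p)

  ⟪⟫-∑ⱽᵥʳ : ∀ {k d} m (x : Vec d) (F : V.Vec (Fin k) m → Vec d) →
            ⟪ x , ∑ⱽᵥ m F ⟫ ≡ ∑ⱽ m (λ f → ⟪ x , F f ⟫)
  ⟪⟫-∑ⱽᵥʳ zero    x F = refl
  ⟪⟫-∑ⱽᵥʳ (suc m) x F =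
    trans (⟪⟫-∑ᵥʳ x (λ a → ∑ⱽᵥ m (λ f → F (a ∷ f))))
          (∑-cong (λ a → ⟪⟫-∑ⱽᵥʳ m x (λ f → F (a ∷ f))))

  ·-∑ⱽᵥ : ∀ {k d} m (M : Mat d) (F : V.Vec (Fin k) m → Vec d) →
          (M · ∑ⱽᵥ m F) ≈ ∑ⱽᵥ m (λ f → M · F f)
  ·-∑ⱽᵥ m M F l = ⟪⟫-∑ⱽᵥʳ m (M l) F

  ∑ⱽᵥ-mem : ∀ {k d} m (U : Subspace d) {F : V.Vec (Fin k) m → Vec d} →
            (∀ f → F f ∈ U) → ∑ⱽᵥ m F ∈ U
  ∑ⱽᵥ-mem zero    U F∈U = F∈U []
  ∑ⱽᵥ-mem (suc m) U F∈U = ∑ᵥ-mem U (λ a → ∑ⱽᵥ-mem m U (λ f → F∈U (a ∷ f)))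

¬¬-∀-Fin : ∀ k {Q : Fin k → Set} → (∀ a → ¬ ¬ Q a) → ¬ ¬ (∀ a → Q a)
¬¬-∀-Fin zero    ¬¬Q ¬∀Q = ¬∀Q (λ ())
¬¬-∀-Fin (suc k) ¬¬Q ¬∀Q =
  ¬¬Q zero (λ Q₀ → ¬¬-∀-Fin k (λ a → ¬¬Q (suc a)) (λ Qₛ → ¬∀Q (λ { zero → Q₀ ; (suc a) → Qₛ a })))

¬¬-∀-Vec : ∀ {k} m {Q : V.Vec (Fin k) m → Set} → (∀ f → ¬ ¬ Q f) → ¬ ¬ (∀ f → Q f)
¬¬-∀-Vec zero    ¬¬Q ¬∀Q = ¬¬Q [] (λ Q[] → ¬∀Q (λ { [] → Q[] }))
¬¬-∀-Vec (suc m) ¬¬Q ¬∀Q =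
  ¬¬-∀-Fin _ (λ a → ¬¬-∀-Vec m (λ f → ¬¬Q (a ∷ f))) (λ Q∷ → ¬∀Q (λ { (a ∷ f) → Q∷ a f }))

module _ {n} {G : Graph n} (S : SubgroupAut G) where
  open SubgroupAut S

  record Subgroup : Set₁ where
    field
      member      : Permutation′ n → Set
      member⇒mem  : ∀ {σ} → member σ → mem σ
      member-id   : member id
      member-comp : ∀ {σ τ} → member σ → member τ → member (τ ∘ₚ σ)
      member-inv  : ∀ {σ} → member σ → member (flip σ)

  stabilizer : Fin n → Subgroup
  stabilizer i = record
    { member      = λ σ → mem σ × σ ⟨$⟩ʳ i ≡ i
    ; member⇒mem  = proj₁
    ; member-id   = mem-id , refl
    ; member-comp = λ {σ} {τ} (p , σi≡i) (q , τi≡i) → mem-comp p q , trans (cong (σ ⟨$⟩ʳ_) τi≡i) σi≡i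
    ; member-inv  = λ {σ} (p , σi≡i) → mem-inv p , trans (cong (flip σ ⟨$⟩ʳ_) (sym σi≡i)) (inverseˡ σ)
    }

module SymmetricRealization (R : RealField) {n d} {G : Graph n} {S : SubgroupAut G}
                            {v : Fin n → LinAlg.Vec R d} (ρ : LinAlg.SymRep R S v) where
  open RealField R
  open FieldProperties R
  open Euclidean R
  open SymRep ρ
  open SubgroupAut S using (mem; mem-comp)
  open Subgroup
  open ≡-Reasoning

  Invariant : Subspace d → Set
  Invariant U = ∀ {σ} (p : mem σ) {x} → x ∈ U → T σ p · x ∈ U

  FixedBy : Subgroup S → Vec d → Set
  FixedBy H y = ∀ {σ} (p : member H σ) → (T σ (member⇒mem H p) · y) ≈ y

  ⟪⟫-fixed : ∀ {σ} (p : mem σ) {y} → (T σ p · y) ≈ y → ∀ x → ⟪ y , T σ p · x ⟫ ≡ ⟪ y , x ⟫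
  ⟪⟫-fixed p Ty≈y x =
    trans (⟪⟫-cong (λ k → sym (Ty≈y k)) (λ _ → refl)) (orthogonal⇒⟪⟫-preserved (T-orth p) _ x)

  T-edge : ∀ {σ} (p : mem σ) a b → (T σ p · (v a -v v b)) ≈ (v (σ ⟨$⟩ʳ a) -v v (σ ⟨$⟩ʳ b))
  T-edge p a b k =
    trans (·-- (T _ p) (v a) (v b) k) (cong₂ (λ s t → s + - t) (T-real p a k) (T-real p b k))

  vertex-fixed : ∀ i → FixedBy (stabilizer S i) (v i)
  vertex-fixed i (p , σi≡i) k = trans (T-real p i k) (cong (λ q → v q k) σi≡i)

  module Averaging (H : Subgroup S) {U : Subspace d} (U-invariant : Invariant U)
                   {a u : Vec d} (a-fixed : FixedBy H a) (u∈U : u ∈ U) where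

    -- H is only a predicate on permutations, so the average runs over all value tables
    -- f ∈ (Fin n)ⁿ, keeping those that tabulate an element of H. Membership is decidable
    -- only under double negation, which is enough since the theorem is a negation.
    record TableInH (f : V.Vec (Fin n) n) : Set where
      constructor tabulates
      field
        perm   : Permutation′ n
        perm∈H : member H perm
        perm≗f : ∀ q → perm ⟨$⟩ʳ q ≡ V.lookup f q

    table-map : ∀ {g f} → member H g → TableInH f → TableInH (V.map (g ⟨$⟩ʳ_) f)
    table-map {g} {f} g∈H (tabulates σ σ∈H σ≗f) =
      tabulates (σ ∘ₚ g) (member-comp H g∈H σ∈H)
      λ q → trans (cong (g ⟨$⟩ʳ_) (σ≗f q)) (sym (lookup-map q (g ⟨$⟩ʳ_) f))

    table-unmap : ∀ {g f} → member H g → TableInH (V.map (g ⟨$⟩ʳ_) f) → TableInH f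
    table-unmap {g} {f} g∈H (tabulates σ σ∈H σ≗gf) =
      tabulates (σ ∘ₚ flip g) (member-comp H (member-inv H g∈H) σ∈H)
      λ q → trans (cong (flip g ⟨$⟩ʳ_) (trans (σ≗gf q) (lookup-map q (g ⟨$⟩ʳ_) f))) (inverseˡ g)

    -- The scaling makes every term contribute ⟨u, a⟩² ≥ 0 to ⟨a, average⟩.
    u′ : Vec d
    u′ = ⟪ u , a ⟫ ·v u

    term : ∀ {f} → Dec (TableInH f) → Vec d
    term (yes (tabulates σ σ∈H _)) = T σ (member⇒mem H σ∈H) · u′
    term (no _)                    = 0v

    term∈U : ∀ {f} (t : Dec (TableInH f)) → term t ∈ U
    term∈U (yes (tabulates σ σ∈H _)) = U-invariant (member⇒mem H σ∈H) (Subspace.mem-· U ⟪ u , a ⟫ u∈U)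
    term∈U (no _)                    = Subspace.mem-0 U

    term-map : ∀ {g} (g∈H : member H g) {f} (t : Dec (TableInH f))
               (t′ : Dec (TableInH (V.map (g ⟨$⟩ʳ_) f))) →
               (T g (member⇒mem H g∈H) · term t) ≈ term t′
    term-map {g} g∈H {f} (yes (tabulates σ σ∈H σ≗f)) (yes (tabulates σ′ σ′∈H σ′≗gf)) k = begin
      (Tg · (T σ pσ · u′)) k
        ≡⟨ ·-⊗ Tg (T σ pσ) u′ k ⟩
      ((Tg ⊗ T σ pσ) · u′) k
        ≡⟨ ·-congˡ (λ r s → sym (T-hom pg pσ r s)) u′ k ⟩
      (T (σ ∘ₚ g) (mem-comp pg pσ) · u′) k
        ≡⟨ ·-congˡ (T-wd (mem-comp pg pσ) (member⇒mem H σ′∈H) σg≗σ′) u′ k ⟩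
      (T σ′ (member⇒mem H σ′∈H) · u′) k ∎
      where
      pg = member⇒mem H g∈H
      pσ = member⇒mem H σ∈H
      Tg = T g pg
      σg≗σ′ : (σ ∘ₚ g) ≈ₚ σ′
      σg≗σ′ q = trans (cong (g ⟨$⟩ʳ_) (σ≗f q)) (trans (sym (lookup-map q (g ⟨$⟩ʳ_) f)) (sym (σ′≗gf q)))
    term-map g∈H (yes t) (no ¬t′) = ⊥-elim (¬t′ (table-map g∈H t))
    term-map g∈H (no ¬t) (yes t′) = ⊥-elim (¬t (table-unmap g∈H t′))
    term-map g∈H (no _)  (no _)   = ·-0 _

    ⟪a,term⟫≡⟪u,a⟫² : ∀ {σ} (σ∈H : member H σ) →
                      ⟪ a , T σ (member⇒mem H σ∈H) · u′ ⟫ ≡ ⟪ u , a ⟫ * ⟪ u , a ⟫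
    ⟪a,term⟫≡⟪u,a⟫² σ∈H = begin
      ⟪ a , T _ (member⇒mem H σ∈H) · u′ ⟫  ≡⟨ ⟪⟫-fixed (member⇒mem H σ∈H) (a-fixed σ∈H) u′ ⟩
      ⟪ a , u′ ⟫                           ≡⟨ ⟪⟫-·ʳ a ⟪ u , a ⟫ u ⟩
      ⟪ u , a ⟫ * ⟪ a , u ⟫                ≡⟨ cong (⟪ u , a ⟫ *_) (⟪⟫-comm a u) ⟩
      ⟪ u , a ⟫ * ⟪ u , a ⟫                ∎

    ⟪a,term⟫-nonneg : ∀ {f} (t : Dec (TableInH f)) → 0ℝ ≤ ⟪ a , term t ⟫
    ⟪a,term⟫-nonneg (yes (tabulates _ σ∈H _)) =
      subst (0ℝ ≤_) (sym (⟪a,term⟫≡⟪u,a⟫² σ∈H)) (0≤x*x ⟪ u , a ⟫)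
    ⟪a,term⟫-nonneg (no _) = inj₂ (sym (⟪⟫-0ʳ a))

    ⟪a,term⟫-pos : ¬ (⟪ u , a ⟫ ≡ 0ℝ) → (t : Dec (TableInH (V.allFin n))) → 0ℝ < ⟪ a , term t ⟫
    ⟪a,term⟫-pos ⟪u,a⟫≢0 (yes (tabulates _ σ∈H _)) =
      subst (0ℝ <_) (sym (⟪a,term⟫≡⟪u,a⟫² σ∈H)) (x≢0⇒0<x*x ⟪u,a⟫≢0)
    ⟪a,term⟫-pos ⟪u,a⟫≢0 (no ¬id) = ⊥-elim (¬id (tabulates id (member-id H) λ q → sym (lookup-allFin q)))

    module _ (decide : ∀ f → Dec (TableInH f)) where

      average : Vec d
      average = ∑ⱽᵥ n (λ f → term (decide f))

      average∈U : average ∈ U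
      average∈U = ∑ⱽᵥ-mem n U (λ f → term∈U (decide f))

      average-fixed : FixedBy H average
      average-fixed {g} g∈H k = begin
        (T g _ · average) k
          ≡⟨ ·-∑ⱽᵥ n (T g _) (λ f → term (decide f)) k ⟩
        ∑ⱽ n (λ f → (T g _ · term (decide f)) k)
          ≡⟨ ∑ⱽ-cong n (λ f → term-map g∈H (decide f) (decide (V.map (g ⟨$⟩ʳ_) f)) k) ⟩
        ∑ⱽ n (λ f → term (decide (V.map (g ⟨$⟩ʳ_) f)) k)
          ≡⟨ ∑ⱽ-map-permute n g (λ f → term (decide f) k) ⟩
        average k ∎

      ⟪a,average⟫-pos : ¬ (⟪ u , a ⟫ ≡ 0ℝ) → 0ℝ < ⟪ a , average ⟫
      ⟪a,average⟫-pos ⟪u,a⟫≢0 =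
        subst (0ℝ <_) (sym (⟪⟫-∑ⱽᵥʳ n a (λ f → term (decide f))))
          (∑ⱽ-pos n (λ f → ⟪ a , term (decide f) ⟫) (λ f → ⟪a,term⟫-nonneg (decide f))
                  (V.allFin n) (⟪a,term⟫-pos ⟪u,a⟫≢0 (decide (V.allFin n))))

  averaged-fixed-vector : (H : Subgroup S) (U : Subspace d) → Invariant U →
                          (a : Vec d) → FixedBy H a → (u : Vec d) → u ∈ U → ¬ (⟪ u , a ⟫ ≡ 0ℝ) →
                          ¬ ¬ (∃[ y ] (y ∈ U × FixedBy H y × ¬ (⟪ a , y ⟫ ≡ 0ℝ)))
  averaged-fixed-vector H U U-invariant a a-fixed u u∈U ⟪u,a⟫≢0 =
    ¬¬-map (λ decide → average decide , average∈U decide , (λ {g} → average-fixed decide {g}) ,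
                       λ ⟪a,y⟫≡0 → <-irrefl (subst (0ℝ <_) ⟪a,y⟫≡0 (⟪a,average⟫-pos decide ⟪u,a⟫≢0)))
           (¬¬-∀-Vec n {λ f → Dec (TableInH f)} (λ _ → ¬¬-excluded-middle))
    where open Averaging H {U} U-invariant {a} {u} a-fixed u∈U

  local-separation : FullLocalDimension G v → ∀ i {p q : Vec d} →
                     (∀ j → adj G i j ≡ true → ⟪ p , v j -v v i ⟫ ≡ ⟪ q , v j -v v i ⟫) → p ≈ q
  local-separation fld i {p} {q} agree k = x∙y⁻¹≈ε⇒x≈y (p k) (q k) (p-q≈0 k)
    where
    p-q⟂edge : ∀ j → adj G i j ≡ true → ⟪ p -v q , v j -v v i ⟫ ≡ 0ℝ
    p-q⟂edge j e = begin
      ⟪ p -v q , x ⟫           ≡⟨ ⟪⟫-comm (p -v q) x ⟩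
      ⟪ x , p -v q ⟫           ≡⟨ ⟪⟫--ʳ x p q ⟩
      ⟪ x , p ⟫ + - ⟪ x , q ⟫  ≡⟨ cong₂ (λ s t → s + - t) (⟪⟫-comm x p) (⟪⟫-comm x q) ⟩
      ⟪ p , x ⟫ + - ⟪ q , x ⟫  ≡⟨ cong (λ s → s + - ⟪ q , x ⟫) (agree j e) ⟩
      ⟪ q , x ⟫ + - ⟪ q , x ⟫  ≡⟨ -‿inverseʳ ⟪ q , x ⟫ ⟩
      0ℝ                       ∎
      where x = v j -v v i
    p-q≈0 : (p -v q) ≈ 0v
    p-q≈0 with fld i (p -v q)
    ... | c , c-off , p-q≈ = ⟂-lincomb⇒≈0 p-q≈ term≡0
      where
      term≡0 : ∀ j → c j * ⟪ p -v q , v j -v v i ⟫ ≡ 0ℝ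
      term≡0 j with adj G i j in e
      ... | true  = trans (cong (c j *_) (p-q⟂edge j e)) (zeroʳ (c j))
      ... | false = trans (cong (_* _) (c-off j e)) (zeroˡ _)

  has-neighbour : FullLocalDimension G v → ∀ {z : Vec d} → ¬ (z ≈ 0v) → ∀ k → ∃[ j ] adj G k j ≡ true
  has-neighbour fld {z} z≉0 k =
    map₂ Bool.¬-not (¬∀⟶∃¬ n (λ j → adj G k j ≡ false) (λ j → adj G k j Bool.≟ false) not-isolated)
    where
    not-isolated : ¬ (∀ j → adj G k j ≡ false)
    not-isolated isolated with fld k z
    ... | c , c-off , z≈ = z≉0 (⟂-lincomb⇒≈0 z≈ (λ j → trans (cong (_* _) (c-off j (isolated j))) (zeroˡ _)))

  module _ (arc : ArcTransitive S) where

    fixed⇒edge-products-equal : ∀ {i j₀ j y} → FixedBy (stabilizer S i) y →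
                                adj G i j₀ ≡ true → adj G i j ≡ true →
                                ⟪ y , v j -v v i ⟫ ≡ ⟪ y , v j₀ -v v i ⟫
    fixed⇒edge-products-equal {i} {j₀} {j} {y} y-fixed e₀ e with arc i j₀ i j e₀ e
    ... | σ , p , σi≡i , σj₀≡j = begin
      ⟪ y , v j -v v i ⟫
        ≡⟨ ⟪⟫-cong (λ _ → refl) (λ k → sym (trans (T-edge p j₀ i k)
                                                 (cong₂ (λ s t → v s k + - v t k) σj₀≡j σi≡i))) ⟩
      ⟪ y , T σ p · (v j₀ -v v i) ⟫
        ≡⟨ ⟪⟫-fixed p (y-fixed (p , σi≡i)) (v j₀ -v v i) ⟩
      ⟪ y , v j₀ -v v i ⟫ ∎

    vertex∈U⇒all-vertices∈U : (U : Subspace d) → Invariant U → (∀ k → ∃[ j ] adj G k j ≡ true) →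
                             ∀ i → v i ∈ U → ∀ k → v k ∈ U
    vertex∈U⇒all-vertices∈U U U-invariant neighbour i vᵢ∈U k
      with arc i (proj₁ (neighbour i)) k (proj₁ (neighbour k)) (proj₂ (neighbour i)) (proj₂ (neighbour k))
    ... | σ , p , σi≡k , _ =
      Subspace.mem-resp U (λ m → trans (T-real p i m) (cong (λ q → v q m) σi≡k)) (U-invariant p vᵢ∈U)

    module _ (fld : FullLocalDimension G v) {i j₀} (e₀ : adj G i j₀ ≡ true) where

      fixed⟂edge⇒≈0 : ∀ {y} → FixedBy (stabilizer S i) y → ⟪ y , v j₀ -v v i ⟫ ≡ 0ℝ → y ≈ 0v
      fixed⟂edge⇒≈0 y-fixed y⟂edge = local-separation fld i λ j e →
        trans (fixed⇒edge-products-equal y-fixed e₀ e) (trans y⟂edge (sym (⟪⟫-0ˡ (v j -v v i))))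

      fixed⇒multiple-of-vertex : ∀ {y} → FixedBy (stabilizer S i) y →
        (⟪ v i , v j₀ -v v i ⟫ ·v y) ≈ (⟪ y , v j₀ -v v i ⟫ ·v v i)
      fixed⇒multiple-of-vertex {y} y-fixed = local-separation fld i λ j e → begin
        ⟪ α ·v y , v j -v v i ⟫    ≡⟨ ⟪⟫-·ˡ α y (v j -v v i) ⟩
        α * ⟪ y , v j -v v i ⟫     ≡⟨ cong (α *_) (fixed⇒edge-products-equal y-fixed e₀ e) ⟩
        α * β                      ≡⟨ *-comm α β ⟩
        β * α                      ≡⟨ cong (β *_) (sym (fixed⇒edge-products-equal (vertex-fixed i) e₀ e)) ⟩
        β * ⟪ v i , v j -v v i ⟫   ≡⟨ sym (⟪⟫-·ˡ β (v i) (v j -v v i)) ⟩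
        ⟪ β ·v v i , v j -v v i ⟫  ∎
        where
        α = ⟪ v i , v j₀ -v v i ⟫
        β = ⟪ y , v j₀ -v v i ⟫

      fixed⇒vertex∈span : ∀ {y} → FixedBy (stabilizer S i) y → ¬ (⟪ v i , y ⟫ ≡ 0ℝ) →
                          ∃[ c ] (v i ≈ (c ·v y))
      fixed⇒vertex∈span {y} y-fixed ⟪vᵢ,y⟫≢0 = b * α , vᵢ≈bαy
        where
        α = ⟪ v i , v j₀ -v v i ⟫
        β = ⟪ y , v j₀ -v v i ⟫

        β≢0 : ¬ (β ≡ 0ℝ)
        β≢0 β≡0 = ⟪vᵢ,y⟫≢0 (trans (⟪⟫-cong (λ _ → refl) (fixed⟂edge⇒≈0 y-fixed β≡0)) (⟪⟫-0ʳ (v i)))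

        b = proj₁ (inverse β β≢0)

        vᵢ≈bαy : v i ≈ ((b * α) ·v y)
        vᵢ≈bαy k = begin
          v i k            ≡⟨ sym (*-identityˡ (v i k)) ⟩
          1ℝ * v i k       ≡⟨ cong (_* v i k) (sym (trans (*-comm b β) (proj₂ (inverse β β≢0)))) ⟩
          (b * β) * v i k  ≡⟨ *-assoc b β (v i k) ⟩
          b * (β * v i k)  ≡⟨ cong (b *_) (sym (fixed⇒multiple-of-vertex y-fixed k)) ⟩
          b * (α * y k)    ≡⟨ sym (*-assoc b α (y k)) ⟩
          (b * α) * y k    ∎

corollary4p11 : (R : RealField) (n d : ℕ) (G : Graph n) (S : SubgroupAut G) →
    ArcTransitive S →
    (v : Fin n → LinAlg.Vec R d) →
    LinAlg.FullDimensional R v →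
    (ρ : LinAlg.SymRep R S v) →
    LinAlg.Reducible R ρ →
    ¬ LinAlg.FullLocalDimension R G v
corollary4p11 R n d G S arc v full-dim ρ (U , (u , u∈U , u≉0) , (w , w∉U) , U-invariant) fld =
  averaged-fixed-vector (stabilizer S i) U U-invariant (v i) (vertex-fixed i) u u∈U ⟪u,vᵢ⟫≢0 λ where
    (y , y∈U , y-fixed , ⟪vᵢ,y⟫≢0) →
      let c , vᵢ≈cy = fixed⇒vertex∈span arc fld (proj₂ (neighbour i)) y-fixed ⟪vᵢ,y⟫≢0
          vᵢ∈U = Subspace.mem-resp U (λ k → sym (vᵢ≈cy k)) (Subspace.mem-· U c y∈U)
      in w∉U (spanning⇒all-mem U full-dim (vertex∈U⇒all-vertices∈U arc U U-invariant neighbour i vᵢ∈U) w)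
  where
  open Euclidean R
  open SymmetricRealization R ρ
  neighbour = has-neighbour fld u≉0
  i = proj₁ (spanning⇒not-orthogonal full-dim u≉0)
  ⟪u,vᵢ⟫≢0 = proj₂ (spanning⇒not-orthogonal full-dim u≉0)
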